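{- Let $k\ge 2$, let $f\colon 2^{\mathcal{N}}\to\mathbb{R}^+$ be a non-negative submodular function, and let $OPT_1,\dots,OPT_k$ be a partition of $\mathcal{N}$ maximizing $\sum_{i=1}^k f(OPT_i)$ among all partitions of $\mathcal{N}$ into $k$ (possibly empty) parts; let $\mathtt{opt}=\sum_{i=1}^k f(OPT_i)$. Let $\pi$ be a uniformly random permutation of $\{1,\dots,k\}$, and for $0\le i\le k$ let $T_i=\bigcup_{j=1}^i OPT_{\pi(j)}$. For a set $A$, let $A(k^{ -1})$ denote a random subset of $A$ containing each element of $A$ independently with probability $1/k$ (independently of $\pi$). Then for every $1 \leq i \leq k$, \[ \mathbb{E}[f(T_i(k^{ -1}))] \geq \left(1 - \frac{1}{k}\right)\mathbb{E}[f(T_{i-1}(k^{ -1}))] + \left(1 - \frac{i - 1}{k(k - 1)}\right)\frac{\mathtt{opt}}{k^2}. \]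
   Context: $f$ is submodular if $f(A)+f(B)\ge f(A\cup B)+f(A\cap B)$ for all $A,B\subseteq\mathcal{N}$. Expectations are over $\pi$ and the random subsets.
   Formalization: The function f takes non-negative rational values instead of values in $\mathbb{R}^+$. -}

module Defs where

open import Data.Bool using (Bool; true; false; if_then_else_; _∧_; not)
open import Data.Nat as ℕ using (ℕ; zero; suc; _<ᵇ_)
open import Data.Integer using (+_)
open import Data.Fin using (Fin; toℕ)
open import Data.Fin.Properties using (_≟_)
open import Data.Fin.Subset using (Subset)
open import Data.Vec using (Vec; []; _∷_; tabulate; lookup; zipWith; foldr)
open import Data.List as L using (List; []; _∷_; map; concatMap; allFin; filter; length)
open import Data.Rational using (ℚ; 0ℚ; 1ℚ; _+_; _*_; _-_; _/_)
open import Relation.Nullary.Decidable using (⌊_⌋)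
open import Relation.Unary using (Decidable)
open import Relation.Nullary using (yes; no)

ℕ→ℚ : ℕ → ℚ
ℕ→ℚ n = + n / 1

-- 1/n as a rational (only used for n ≥ 1; inv 0 = 0 is a dummy value)
inv : ℕ → ℚ
inv zero = 0ℚ
inv (suc n) = + 1 / suc n

sumℚ : List ℚ → ℚ
sumℚ = L.foldr _+_ 0ℚ

allVecs : {A : Set} → List A → (m : ℕ) → List (Vec A m)
allVecs xs zero = [] ∷ []
allVecs xs (suc m) = concatMap (λ x → map (x ∷_) (allVecs xs m)) xs

allSubsets : (n : ℕ) → List (Subset n)
allSubsets n = allVecs (true ∷ false ∷ []) n

distinct : {k m : ℕ} → Vec (Fin k) m → Bool
distinct [] = true
distinct (x ∷ xs) = not (foldr _ (λ y b → ⌊ x ≟ y ⌋ Data.Bool.∨ b) false xs) ∧ distinct xs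

-- all permutations of {0,…,k-1}, π represented as the vector (π(0),…,π(k-1))
allPerms : (k : ℕ) → List (Vec (Fin k) k)
allPerms k = L.filterᵇ distinct (allVecs (allFin k) k)

Eπ : (k : ℕ) → (Vec (Fin k) k → ℚ) → ℚ
Eπ k g = inv (length (allPerms k)) * sumℚ (map g (allPerms k))

-- probability that A(q) (each element of A independently with prob. q) equals B
weight : {n : ℕ} → ℚ → Subset n → Subset n → ℚ
weight q A B = foldr _ _*_ 1ℚ (zipWith w A B)
  where
  w : Bool → Bool → ℚ
  w true  true  = q
  w true  false = 1ℚ - q
  w false true  = 0ℚ
  w false false = 1ℚ

Esub : {n : ℕ} → ℚ → Subset n → (Subset n → ℚ) → ℚ
Esub {n} q A g = sumℚ (map (λ B → weight q A B * g B) (allSubsets n))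

part : {n k : ℕ} → (Fin n → Fin k) → Fin k → Subset n
part p j = tabulate (λ x → ⌊ p x ≟ j ⌋)

partValue : {n k : ℕ} → (Subset n → ℚ) → (Fin n → Fin k) → ℚ
partValue {k = k} f p = sumℚ (map (λ j → f (part p j)) (allFin k))

-- T_i = ⋃_{j=1}^{i} OPT_{π(j)}  (π 0-indexed: positions 0,…,i-1)
T : {n k : ℕ} → (Fin n → Fin k) → Vec (Fin k) k → ℕ → Subset n
T {n} {k} p π i = tabulate (λ x →
  L.foldr (λ j b → ((toℕ j <ᵇ i) ∧ ⌊ lookup π j ≟ p x ⌋) Data.Bool.∨ b) false (allFin k))

{-# OPTIONS --safe #-}
module Submission where

-- Let p = i - 1 and P = OPT_π(p), the part that turns T_p into T_{p+1}. Since T_p and P are disjoint,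
-- T_{p+1}(q) is T_p(q) ∪ P(q) with independent samples, and by submodularity
-- E f(X ∪ P(q)) ≥ (1 - q) f(X) + q f(X ∪ P) for every X; hence
-- E f(T_{p+1}(q)) ≥ (1 - q) E f(T_p(q)) + q E f(T_p(q) ∪ P).
-- For the last term, E g(A(q)) ≥ g(∅) + q Σ_{m ∈ A} Δ_m g, with Δ_m g the increments of g along a fixed
-- chain. This bound is linear in the law of A, so it can be averaged over π. Among the permutations with
-- π(p) = j, every element outside OPT_j lies in T_p for a fraction p/(k-1) of them, while the increments of
-- g = f(· ∪ OPT_j) vanish on OPT_j. The average is therefore at least
-- f(OPT_j) + (q p/(k-1)) (f(𝒩) - f(OPT_j)) ≥ (1 - q p/(k-1)) f(OPT_j), as f is non-negative, and averaging
-- over j = π(p) yields the opt term. Both counts of permutations follow from the invariance of the uniform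
-- distribution under transpositions.

open import Defs
open import Algebra.Bundles using (CommutativeRing)
import Algebra.Properties.IdempotentCommutativeMonoid as IdempotentCommutativeMonoidProperties
open import Data.Bool using (Bool; true; false; if_then_else_; not; _∧_; _∨_)
open import Data.Bool.Properties using (∧-zeroʳ; ∨-zeroʳ; ∨-identityʳ; ∨-assoc; T-≡)
open import Data.Empty using (⊥-elim)
open import Data.Fin using (Fin; zero; suc; toℕ; fromℕ<)
open import Data.Fin.Permutation using (Permutation; _⟨$⟩ʳ_; _⟨$⟩ˡ_; inverseˡ; inverseʳ; transpose)
import Data.Fin.Permutation.Components as PC
open import Data.Fin.Properties using (_≟_; suc-injective; toℕ-fromℕ<)
open import Data.Fin.Subset using (Subset; _∪_; _∩_; ⊥; ⊤)
open import Data.Fin.Subset.Properties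
  using ( ∪-identityˡ; ∪-identityʳ; ∪-zeroʳ; ∩-identityˡ; ∩-identityʳ; ∩-zeroˡ
        ; ∪-distribˡ-∩; ∪-distribʳ-∩; ∩-distribʳ-∪
        ; ∪-idempotentCommutativeMonoid; ∩-idempotentCommutativeMonoid )
import Data.Integer as ℤ
import Data.Integer.Properties as ℤₚ
open import Data.List as List using (List; []; _∷_; _++_; map; concatMap; allFin; length)
open import Data.List.Membership.Propositional using (_∈_; lose)
open import Data.List.Membership.Propositional.Properties
  using (∈-map⁺; ∈-concatMap⁺; ∈-allFin; ∈-filter⁺; ∈-filter⁻)
open import Data.List.Relation.Unary.Any using (here; there)
open import Data.Nat as ℕ using (ℕ; zero; suc; _∸_; NonZero)
import Data.Nat.Coprimality as Coprime
import Data.Nat.Properties as ℕₚ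
open import Data.Product using (_×_; _,_; proj₁; proj₂)
open import Data.Rational using (ℚ; 0ℚ; 1ℚ; _+_; _*_; _-_; -_; _≤_; _≥_; *≤*; mkℚ; nonNegative)
open import Data.Rational.Properties hiding (_≟_)
open import Data.Rational.Solver using (module +-*-Solver)
open import Data.Vec as Vec using (Vec; []; _∷_; lookup; _[_]≔_; tabulate)
open import Data.Vec.Properties using (∷-injective; tabulate-∘; tabulate-cong; lookup∘tabulate; lookup-map)
open import Function using (_∘_; id)
open import Function.Bundles using (Equivalence)
open import Function.Definitions using (Injective)
open import Relation.Binary.PropositionalEquality
  using (_≡_; _≢_; refl; sym; trans; cong; cong₂; subst; subst₂; module ≡-Reasoning)
open import Relation.Nullary using (yes; no)
open import Relation.Nullary.Decidable using (⌊_⌋; T?)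

open import Algebra.Properties.Semiring.Sum (CommutativeRing.semiring +-*-commutativeRing)
  using (sum-syntax; sum-cong-≗; sum-replicate-zero; sum-permute; ∑-distrib-+; ∑-comm; *-distribˡ-sum)
open +-*-Solver

private variable
  A B : Set
  n k m : ℕ

-- Rational arithmetic

ℕ→ℚ≡mkℚ : ∀ n → ℕ→ℚ n ≡ mkℚ (ℤ.+ n) 0 (Coprime.sym (Coprime.1-coprimeTo n))
ℕ→ℚ≡mkℚ n = normalize-coprime (Coprime.sym (Coprime.1-coprimeTo n))

inv-suc≡mkℚ : ∀ n → inv (suc n) ≡ mkℚ (ℤ.+ 1) n (Coprime.1-coprimeTo (suc n))
inv-suc≡mkℚ n = normalize-coprime (Coprime.1-coprimeTo (suc n))

ℕ→ℚ-0 : ℕ→ℚ 0 ≡ 0ℚ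
ℕ→ℚ-0 = ℕ→ℚ≡mkℚ 0

ℕ→ℚ-suc : ∀ n → ℕ→ℚ (suc n) ≡ 1ℚ + ℕ→ℚ n
ℕ→ℚ-suc n rewrite ℕ→ℚ≡mkℚ n | ℤₚ.*-identityʳ (ℤ.+ n) = refl

ℕ→ℚ-∸1 : ∀ {p k} → p ℕ.< k → ℕ→ℚ k ≡ 1ℚ + ℕ→ℚ (k ∸ 1)
ℕ→ℚ-∸1 {k = suc k} _ = ℕ→ℚ-suc k

ℕ→ℚ-+ : ∀ m n → ℕ→ℚ (m ℕ.+ n) ≡ ℕ→ℚ m + ℕ→ℚ n
ℕ→ℚ-+ zero n rewrite ℕ→ℚ-0 = sym (+-identityˡ (ℕ→ℚ n))
ℕ→ℚ-+ (suc m) n rewrite ℕ→ℚ-suc (m ℕ.+ n) | ℕ→ℚ-suc m | ℕ→ℚ-+ m n =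
  sym (+-assoc 1ℚ (ℕ→ℚ m) (ℕ→ℚ n))

ℕ→ℚ-* : ∀ m n → ℕ→ℚ (m ℕ.* n) ≡ ℕ→ℚ m * ℕ→ℚ n
ℕ→ℚ-* zero n rewrite ℕ→ℚ-0 = sym (*-zeroˡ (ℕ→ℚ n))
ℕ→ℚ-* (suc m) n rewrite ℕ→ℚ-+ n (m ℕ.* n) | ℕ→ℚ-suc m | ℕ→ℚ-* m n =
  solve 2 (λ m n → n :+ m :* n := (con 1ℚ :+ m) :* n) refl (ℕ→ℚ m) (ℕ→ℚ n)

0≤ℕ→ℚ : ∀ n → 0ℚ ≤ ℕ→ℚ n
0≤ℕ→ℚ n rewrite ℕ→ℚ≡mkℚ n = nonNegative⁻¹ _

0≤inv : ∀ n → 0ℚ ≤ inv n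
0≤inv zero    = ≤-refl
0≤inv (suc n) rewrite inv-suc≡mkℚ n = nonNegative⁻¹ _

inv≤1 : ∀ n → inv n ≤ 1ℚ
inv≤1 zero    = nonNegative⁻¹ 1ℚ
inv≤1 (suc n) rewrite inv-suc≡mkℚ n = *≤* (ℤ.+≤+ (ℕ.s≤s ℕ.z≤n))

inv-inverseˡ : ∀ n → .{{NonZero n}} → inv n * ℕ→ℚ n ≡ 1ℚ
inv-inverseˡ (suc n) rewrite inv-suc≡mkℚ n | ℕ→ℚ≡mkℚ (suc n) =
  *-inverseˡ (mkℚ (ℤ.+ suc n) 0 (Coprime.sym (Coprime.1-coprimeTo (suc n))))

*-solveˡ : ∀ x a {b c : ℚ} → x * a ≡ 1ℚ → a * b ≡ c → b ≡ x * c
*-solveˡ x a {b} {c} xa≡1 ab≡c = begin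
  b            ≡⟨ *-identityˡ b ⟨
  1ℚ * b       ≡⟨ cong (_* b) xa≡1 ⟨
  x * a * b    ≡⟨ *-assoc x a b ⟩
  x * (a * b)  ≡⟨ cong (x *_) ab≡c ⟩
  x * c        ∎
  where open ≡-Reasoning

inv-* : ∀ m n → .{{_ : NonZero m}} .{{_ : NonZero n}} → inv (m ℕ.* n) ≡ inv m * inv n
inv-* m@(suc _) n@(suc _) = begin
  inv (m ℕ.* n)
    ≡⟨ *-solveˡ (inv m * inv n) (ℕ→ℚ (m ℕ.* n)) inverse
                (trans (*-comm (ℕ→ℚ (m ℕ.* n)) _) (inv-inverseˡ (m ℕ.* n))) ⟩
  inv m * inv n * 1ℚ
    ≡⟨ *-identityʳ (inv m * inv n) ⟩
  inv m * inv n ∎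
  where
  open ≡-Reasoning
  inverse : inv m * inv n * ℕ→ℚ (m ℕ.* n) ≡ 1ℚ
  inverse = begin
    inv m * inv n * ℕ→ℚ (m ℕ.* n)    ≡⟨ cong (inv m * inv n *_) (ℕ→ℚ-* m n) ⟩
    inv m * inv n * (ℕ→ℚ m * ℕ→ℚ n)  ≡⟨ solve 4 (λ x y a b → (x :* y) :* (a :* b) := (x :* a) :* (y :* b))
                                          refl (inv m) (inv n) (ℕ→ℚ m) (ℕ→ℚ n) ⟩
    inv m * ℕ→ℚ m * (inv n * ℕ→ℚ n)  ≡⟨ cong₂ _*_ (inv-inverseˡ m) (inv-inverseˡ n) ⟩
    1ℚ * 1ℚ                          ≡⟨⟩
    1ℚ                               ∎

*-monoˡ-≤-0≤ : ∀ {c a b : ℚ} → 0ℚ ≤ c → a ≤ b → c * a ≤ c * b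
*-monoˡ-≤-0≤ {c} 0≤c = *-monoˡ-≤-nonNeg c {{nonNegative 0≤c}}

0≤*0≤⇒0≤ : ∀ {a b : ℚ} → 0ℚ ≤ a → 0ℚ ≤ b → 0ℚ ≤ a * b
0≤*0≤⇒0≤ {a} 0≤a 0≤b = subst (_≤ a * _) (*-zeroʳ a) (*-monoˡ-≤-0≤ 0≤a 0≤b)

p≤q⇒0≤q-p : ∀ {p q : ℚ} → p ≤ q → 0ℚ ≤ q - p
p≤q⇒0≤q-p {p} {q} p≤q = subst (_≤ q - p) (+-inverseʳ p) (+-monoˡ-≤ (- p) p≤q)

-- Finite sums

𝟙 : Bool → ℚ
𝟙 b = if b then 1ℚ else 0ℚ

0≤𝟙 : ∀ b → 0ℚ ≤ 𝟙 b
0≤𝟙 true  = nonNegative⁻¹ 1ℚ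
0≤𝟙 false = ≤-refl

𝟙-∧ : ∀ a b → 𝟙 (a ∧ b) ≡ 𝟙 a * 𝟙 b
𝟙-∧ true  b = sym (*-identityˡ (𝟙 b))
𝟙-∧ false b = sym (*-zeroˡ (𝟙 b))

∑<-const : ∀ n (c : ℚ) → ∑[ i < n ] c ≡ ℕ→ℚ n * c
∑<-const zero    c rewrite ℕ→ℚ-0 = sym (*-zeroˡ c)
∑<-const (suc n) c rewrite ∑<-const n c | ℕ→ℚ-suc n =
  solve 2 (λ c n → c :+ n :* c := (con 1ℚ :+ n) :* c) refl c (ℕ→ℚ n)

∑<-mono : ∀ n {g h : Fin n → ℚ} → (∀ i → g i ≤ h i) → ∑[ i < n ] g i ≤ ∑[ i < n ] h i
∑<-mono zero    g≤h = ≤-refl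
∑<-mono (suc n) g≤h = +-mono-≤ (g≤h zero) (∑<-mono n (g≤h ∘ suc))

∑<-δ : ∀ n (j : Fin n) (c : Fin n → ℚ) → ∑[ i < n ] (𝟙 ⌊ j ≟ i ⌋ * c i) ≡ c j
∑<-δ (suc n) zero    c = begin
  1ℚ * c zero + ∑[ i < n ] (0ℚ * c (suc i))
    ≡⟨ cong₂ _+_ (*-identityˡ (c zero)) (sum-cong-≗ (*-zeroˡ ∘ c ∘ suc)) ⟩
  c zero + ∑[ i < n ] 0ℚ
    ≡⟨ cong (c zero +_) (sum-replicate-zero n) ⟩
  c zero + 0ℚ
    ≡⟨ +-identityʳ _ ⟩
  c zero ∎
  where open ≡-Reasoning
∑<-δ (suc n) (suc j) c = begin
  0ℚ * c zero + ∑[ i < n ] (𝟙 ⌊ suc j ≟ suc i ⌋ * c (suc i))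
    ≡⟨ cong₂ _+_ (*-zeroˡ (c zero)) (sum-cong-≗ suc-step) ⟩
  0ℚ + ∑[ i < n ] (𝟙 ⌊ j ≟ i ⌋ * c (suc i))
    ≡⟨ +-identityˡ _ ⟩
  ∑[ i < n ] (𝟙 ⌊ j ≟ i ⌋ * c (suc i))
    ≡⟨ ∑<-δ n j (c ∘ suc) ⟩
  c (suc j) ∎
  where
  open ≡-Reasoning
  suc-step : ∀ i → 𝟙 ⌊ suc j ≟ suc i ⌋ * c (suc i) ≡ 𝟙 ⌊ j ≟ i ⌋ * c (suc i)
  suc-step i with j ≟ i
  ... | yes _ = refl
  ... | no  _ = refl

∑<-δ-1 : ∀ n (j : Fin n) → ∑[ i < n ] 𝟙 ⌊ j ≟ i ⌋ ≡ 1ℚ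
∑<-δ-1 n j = trans (sum-cong-≗ (λ i → sym (*-identityʳ (𝟙 ⌊ j ≟ i ⌋)))) (∑<-δ n j (λ _ → 1ℚ))

-- In this form Esub, Eπ and partValue are list sums by definition.
sumOver : List A → (A → ℚ) → ℚ
sumOver xs g = sumℚ (map g xs)
infixl 10 sumOver
syntax sumOver xs (λ x → e) = ∑[ x ∈ xs ] e

∑∈-cong : ∀ (xs : List A) {g h : A → ℚ} → (∀ {x} → x ∈ xs → g x ≡ h x) →
          ∑[ x ∈ xs ] g x ≡ ∑[ x ∈ xs ] h x
∑∈-cong []       g≡h = refl
∑∈-cong (x ∷ xs) g≡h = cong₂ _+_ (g≡h (here refl)) (∑∈-cong xs (g≡h ∘ there))

∑∈-mono : ∀ (xs : List A) {g h : A → ℚ} → (∀ {x} → x ∈ xs → g x ≤ h x) →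
          ∑[ x ∈ xs ] g x ≤ ∑[ x ∈ xs ] h x
∑∈-mono []       g≤h = ≤-refl
∑∈-mono (x ∷ xs) g≤h = +-mono-≤ (g≤h (here refl)) (∑∈-mono xs (g≤h ∘ there))

∑∈-++ : ∀ (xs ys : List A) (g : A → ℚ) →
        ∑[ x ∈ xs ++ ys ] g x ≡ ∑[ x ∈ xs ] g x + ∑[ x ∈ ys ] g x
∑∈-++ []       ys g = sym (+-identityˡ _)
∑∈-++ (x ∷ xs) ys g rewrite ∑∈-++ xs ys g = sym (+-assoc (g x) _ _)

∑∈-distrib-+ : ∀ (xs : List A) (g h : A → ℚ) →
               ∑[ x ∈ xs ] (g x + h x) ≡ ∑[ x ∈ xs ] g x + ∑[ x ∈ xs ] h x
∑∈-distrib-+ []       g h = refl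
∑∈-distrib-+ (x ∷ xs) g h rewrite ∑∈-distrib-+ xs g h =
  solve 4 (λ a b c d → (a :+ b) :+ (c :+ d) := (a :+ c) :+ (b :+ d)) refl
    (g x) (h x) (∑[ y ∈ xs ] g y) (∑[ y ∈ xs ] h y)

*-distribˡ-∑∈ : ∀ (xs : List A) (c : ℚ) (g : A → ℚ) →
                c * ∑[ x ∈ xs ] g x ≡ ∑[ x ∈ xs ] (c * g x)
*-distribˡ-∑∈ []       c g = *-zeroʳ c
*-distribˡ-∑∈ (x ∷ xs) c g rewrite sym (*-distribˡ-∑∈ xs c g) = *-distribˡ-+ c (g x) _

*-distribʳ-∑∈ : ∀ (xs : List A) (c : ℚ) (g : A → ℚ) →
                (∑[ x ∈ xs ] g x) * c ≡ ∑[ x ∈ xs ] (g x * c)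
*-distribʳ-∑∈ xs c g = trans (*-comm _ c)
  (trans (*-distribˡ-∑∈ xs c g) (∑∈-cong xs (λ {x} _ → *-comm c (g x))))

∑∈-const : ∀ (xs : List A) (c : ℚ) → ∑[ x ∈ xs ] c ≡ ℕ→ℚ (length xs) * c
∑∈-const []       c rewrite ℕ→ℚ-0 = sym (*-zeroˡ c)
∑∈-const (x ∷ xs) c rewrite ∑∈-const xs c | ℕ→ℚ-suc (length xs) =
  solve 2 (λ c n → c :+ n :* c := (con 1ℚ :+ n) :* c) refl c (ℕ→ℚ (length xs))

∑∈-map : (f : A → B) (xs : List A) (g : B → ℚ) →
         ∑[ y ∈ map f xs ] g y ≡ ∑[ x ∈ xs ] g (f x)
∑∈-map f []       g = refl
∑∈-map f (x ∷ xs) g = cong (g (f x) +_) (∑∈-map f xs g)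

∑∈-concatMap : (f : A → List B) (xs : List A) (g : B → ℚ) →
               ∑[ y ∈ concatMap f xs ] g y ≡ ∑[ x ∈ xs ] ∑[ y ∈ f x ] g y
∑∈-concatMap f []       g = refl
∑∈-concatMap f (x ∷ xs) g =
  trans (∑∈-++ (f x) (concatMap f xs) g) (cong (∑[ y ∈ f x ] g y +_) (∑∈-concatMap f xs g))

∑∈-filterᵇ : ∀ (d : A → Bool) (xs : List A) (g : A → ℚ) →
             ∑[ x ∈ List.filterᵇ d xs ] g x ≡ ∑[ x ∈ xs ] (if d x then g x else 0ℚ)
∑∈-filterᵇ d []       g = refl
∑∈-filterᵇ d (x ∷ xs) g with d x
... | true  = cong (g x +_) (∑∈-filterᵇ d xs g)
... | false = trans (∑∈-filterᵇ d xs g) (sym (+-identityˡ _))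

∑∈-∑<-comm : ∀ (xs : List A) n (H : A → Fin n → ℚ) →
             ∑[ x ∈ xs ] ∑[ i < n ] H x i ≡ ∑[ i < n ] ∑[ x ∈ xs ] H x i
∑∈-∑<-comm []       n H = sym (sum-replicate-zero n)
∑∈-∑<-comm (x ∷ xs) n H rewrite ∑∈-∑<-comm xs n H = sym (∑-distrib-+ (H x) _)

∑∈-tabulate : ∀ n (g : Fin n → A) (h : A → ℚ) → ∑[ x ∈ List.tabulate g ] h x ≡ ∑[ i < n ] h (g i)
∑∈-tabulate zero    g h = refl
∑∈-tabulate (suc n) g h = cong (h (g zero) +_) (∑∈-tabulate n (g ∘ suc) h)

∑∈-allFin : ∀ n (h : Fin n → ℚ) → ∑[ x ∈ allFin n ] h x ≡ ∑[ i < n ] h i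
∑∈-allFin n = ∑∈-tabulate n id

-- Submodular functions and random subsets

Submodular : (Subset n → ℚ) → Set
Submodular f = ∀ A B → f (A ∪ B) + f (A ∩ B) ≤ f A + f B

module _ {n : ℕ} (f : Subset n → ℚ) (f-submodular : Submodular f) where

  private
    module ∪ = IdempotentCommutativeMonoidProperties (∪-idempotentCommutativeMonoid n)
    module ∩ = IdempotentCommutativeMonoidProperties (∩-idempotentCommutativeMonoid n)

  submodular-∘-homomorphism : (h : Subset n → Subset n) →
    (∀ A B → h (A ∪ B) ≡ h A ∪ h B) → (∀ A B → h (A ∩ B) ≡ h A ∩ h B) → Submodular (f ∘ h)
  submodular-∘-homomorphism h h-∪ h-∩ A B =
    subst₂ (λ U V → f U + f V ≤ f (h A) + f (h B)) (sym (h-∪ A B)) (sym (h-∩ A B))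
      (f-submodular (h A) (h B))

  submodular-∪ˡ : ∀ C → Submodular (λ X → f (C ∪ X))
  submodular-∪ˡ C = submodular-∘-homomorphism (C ∪_) (∪.∙-distrˡ-∙ C) (∪-distribˡ-∩ C)

  submodular-∪ʳ : ∀ C → Submodular (λ X → f (X ∪ C))
  submodular-∪ʳ C =
    submodular-∘-homomorphism (_∪ C) (λ A B → ∪.∙-distrʳ-∙ C A B) (λ A B → ∪-distribʳ-∩ C A B)

  submodular-∩ʳ : ∀ C → Submodular (λ X → f (X ∩ C))
  submodular-∩ʳ C =
    submodular-∘-homomorphism (_∩ C) (λ A B → ∩-distribʳ-∪ C A B) (λ A B → ∩.∙-distrʳ-∙ C A B)

𝔼 : ℚ → Subset n → (Subset n → ℚ) → ℚ
𝔼 q []          g = g []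
𝔼 q (true ∷ A)  g = q * 𝔼 q A (g ∘ (true ∷_)) + (1ℚ - q) * 𝔼 q A (g ∘ (false ∷_))
𝔼 q (false ∷ A) g = 𝔼 q A (g ∘ (false ∷_))

private
  Esub-∷ : ∀ q a (A : Subset n) g → Esub q (a ∷ A) g ≡
    ∑[ B ∈ allSubsets n ] (weight q (a ∷ A) (true ∷ B) * g (true ∷ B)) +
    ∑[ B ∈ allSubsets n ] (weight q (a ∷ A) (false ∷ B) * g (false ∷ B))
  Esub-∷ {n} q a A g = begin
    Esub q (a ∷ A) g
      ≡⟨ ∑∈-concatMap (λ b → map (b ∷_) (allSubsets n)) (true ∷ false ∷ []) G ⟩
    ∑[ B ∈ map (true ∷_) (allSubsets n) ] G B + (∑[ B ∈ map (false ∷_) (allSubsets n) ] G B + 0ℚ)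
      ≡⟨ cong₂ _+_ (∑∈-map (true ∷_) (allSubsets n) G)
                   (trans (+-identityʳ _) (∑∈-map (false ∷_) (allSubsets n) G)) ⟩
    ∑[ B ∈ allSubsets n ] G (true ∷ B) + ∑[ B ∈ allSubsets n ] G (false ∷ B) ∎
    where
    open ≡-Reasoning
    G : Subset (suc n) → ℚ
    G B = weight q (a ∷ A) B * g B

  ∑-scaled-weight : ∀ c q (A : Subset n) g →
    ∑[ B ∈ allSubsets n ] (c * weight q A B * g B) ≡ c * Esub q A g
  ∑-scaled-weight {n} c q A g = trans (∑∈-cong (allSubsets n) (λ _ → *-assoc c _ _))
                                      (sym (*-distribˡ-∑∈ (allSubsets n) c _))

Esub≡𝔼 : ∀ q (A : Subset n) g → Esub q A g ≡ 𝔼 q A g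
Esub≡𝔼 q []          g = trans (+-identityʳ _) (*-identityˡ (g []))
Esub≡𝔼 q (true ∷ A)  g = trans (Esub-∷ q true A g) (cong₂ _+_
  (trans (∑-scaled-weight q q A (g ∘ (true ∷_))) (cong (q *_) (Esub≡𝔼 q A _)))
  (trans (∑-scaled-weight (1ℚ - q) q A (g ∘ (false ∷_))) (cong ((1ℚ - q) *_) (Esub≡𝔼 q A _))))
Esub≡𝔼 q (false ∷ A) g = begin
  Esub q (false ∷ A) g
    ≡⟨ Esub-∷ q false A g ⟩
  ∑[ B ∈ allSubsets _ ] (0ℚ * weight q A B * g (true ∷ B)) + ∑[ B ∈ allSubsets _ ] (1ℚ * weight q A B * g (false ∷ B))
    ≡⟨ cong₂ _+_ (∑-scaled-weight 0ℚ q A (g ∘ (true ∷_))) (∑-scaled-weight 1ℚ q A (g ∘ (false ∷_))) ⟩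
  0ℚ * Esub q A (g ∘ (true ∷_)) + 1ℚ * Esub q A (g ∘ (false ∷_))
    ≡⟨ cong₂ _+_ (*-zeroˡ (Esub q A (g ∘ (true ∷_)))) (*-identityˡ (Esub q A (g ∘ (false ∷_)))) ⟩
  0ℚ + Esub q A (g ∘ (false ∷_))
    ≡⟨ +-identityˡ _ ⟩
  Esub q A (g ∘ (false ∷_))
    ≡⟨ Esub≡𝔼 q A _ ⟩
  𝔼 q A (g ∘ (false ∷_)) ∎
  where open ≡-Reasoning

𝔼-linear : ∀ q (A : Subset n) a b G H →
  𝔼 q A (λ X → a * G X + b * H X) ≡ a * 𝔼 q A G + b * 𝔼 q A H
𝔼-linear q []          a b G H = refl
𝔼-linear q (true ∷ A)  a b G H
  rewrite 𝔼-linear q A a b (G ∘ (true ∷_)) (H ∘ (true ∷_))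
        | 𝔼-linear q A a b (G ∘ (false ∷_)) (H ∘ (false ∷_)) =
  solve 7 (λ q a b g₁ g₀ h₁ h₀ →
      q :* (a :* g₁ :+ b :* h₁) :+ (con 1ℚ :- q) :* (a :* g₀ :+ b :* h₀)
    := a :* (q :* g₁ :+ (con 1ℚ :- q) :* g₀) :+ b :* (q :* h₁ :+ (con 1ℚ :- q) :* h₀))
    refl q a b (𝔼 q A (G ∘ (true ∷_))) (𝔼 q A (G ∘ (false ∷_)))
               (𝔼 q A (H ∘ (true ∷_))) (𝔼 q A (H ∘ (false ∷_)))
𝔼-linear q (false ∷ A) a b G H = 𝔼-linear q A a b (G ∘ (false ∷_)) (H ∘ (false ∷_))

𝔼-+-const : ∀ q (A : Subset n) G c → 𝔼 q A (λ X → G X + c) ≡ 𝔼 q A G + c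
𝔼-+-const q []          G c = refl
𝔼-+-const q (true ∷ A)  G c
  rewrite 𝔼-+-const q A (G ∘ (true ∷_)) c | 𝔼-+-const q A (G ∘ (false ∷_)) c =
  solve 4 (λ q c g₁ g₀ →
      q :* (g₁ :+ c) :+ (con 1ℚ :- q) :* (g₀ :+ c) := (q :* g₁ :+ (con 1ℚ :- q) :* g₀) :+ c)
    refl q c (𝔼 q A (G ∘ (true ∷_))) (𝔼 q A (G ∘ (false ∷_)))
𝔼-+-const q (false ∷ A) G c = 𝔼-+-const q A (G ∘ (false ∷_)) c

𝔼-mono : ∀ {q} → 0ℚ ≤ q → q ≤ 1ℚ → (A : Subset n) {g h : Subset n → ℚ} →
         (∀ B → g B ≤ h B) → 𝔼 q A g ≤ 𝔼 q A h
𝔼-mono 0≤q q≤1 []          g≤h = g≤h []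
𝔼-mono 0≤q q≤1 (true ∷ A)  g≤h = +-mono-≤
  (*-monoˡ-≤-0≤ 0≤q (𝔼-mono 0≤q q≤1 A (g≤h ∘ (true ∷_))))
  (*-monoˡ-≤-0≤ (p≤q⇒0≤q-p q≤1) (𝔼-mono 0≤q q≤1 A (g≤h ∘ (false ∷_))))
𝔼-mono 0≤q q≤1 (false ∷ A) g≤h = 𝔼-mono 0≤q q≤1 A (g≤h ∘ (false ∷_))

𝔼-∩ : ∀ q (A : Subset n) g → 𝔼 q A g ≡ 𝔼 q A (λ Y → g (Y ∩ A))
𝔼-∩ q []          g = refl
𝔼-∩ q (true ∷ A)  g = cong₂ (λ u v → q * u + (1ℚ - q) * v)
                             (𝔼-∩ q A (g ∘ (true ∷_))) (𝔼-∩ q A (g ∘ (false ∷_)))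
𝔼-∩ q (false ∷ A) g = 𝔼-∩ q A (g ∘ (false ∷_))

𝔼-∪ : ∀ q (A B : Subset n) F → A ∩ B ≡ ⊥ →
      𝔼 q (A ∪ B) F ≡ 𝔼 q A (λ X → 𝔼 q B (λ Y → F (X ∪ Y)))
𝔼-∪ q []          []          F _ = refl
𝔼-∪ q (true ∷ A)  (true ∷ B)  F ()
𝔼-∪ q (true ∷ A)  (false ∷ B) F A∩B≡⊥ = cong₂ (λ u v → q * u + (1ℚ - q) * v)
  (𝔼-∪ q A B (F ∘ (true ∷_)) (proj₂ (∷-injective A∩B≡⊥)))
  (𝔼-∪ q A B (F ∘ (false ∷_)) (proj₂ (∷-injective A∩B≡⊥)))
𝔼-∪ q (false ∷ A) (true ∷ B)  F A∩B≡⊥ = trans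
  (cong₂ (λ u v → q * u + (1ℚ - q) * v)
    (𝔼-∪ q A B (F ∘ (true ∷_)) (proj₂ (∷-injective A∩B≡⊥)))
    (𝔼-∪ q A B (F ∘ (false ∷_)) (proj₂ (∷-injective A∩B≡⊥))))
  (sym (𝔼-linear q A q (1ℚ - q) _ _))
𝔼-∪ q (false ∷ A) (false ∷ B) F A∩B≡⊥ = 𝔼-∪ q A B (F ∘ (false ∷_)) (proj₂ (∷-injective A∩B≡⊥))

-- marginal g m is the gain of adding m to {m+1, …, n-1}.
marginal : (Subset n → ℚ) → Fin n → ℚ
marginal {suc n} g zero    = g (true ∷ ⊤) - g (false ∷ ⊤)
marginal {suc n} g (suc m) = marginal (g ∘ (false ∷_)) m

∑-marginal : (g : Subset n → ℚ) → ∑[ m < n ] marginal g m ≡ g ⊤ - g ⊥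
∑-marginal {zero}  g = sym (+-inverseʳ (g []))
∑-marginal {suc n} g rewrite ∑-marginal (g ∘ (false ∷_)) =
  solve 3 (λ a b c → (a :- b) :+ (b :- c) := a :- c) refl (g (true ∷ ⊤)) (g (false ∷ ⊤)) (g (false ∷ ⊥))

marginal≡0 : (g : Subset n → ℚ) (m : Fin n) →
             (∀ Y → g (Y [ m ]≔ true) ≡ g (Y [ m ]≔ false)) → marginal g m ≡ 0ℚ
marginal≡0 {suc n} g zero    g-indep =
  trans (cong (_- g (false ∷ ⊤)) (g-indep (true ∷ ⊤))) (+-inverseʳ (g (false ∷ ⊤)))
marginal≡0 {suc n} g (suc m) g-indep = marginal≡0 (g ∘ (false ∷_)) m (g-indep ∘ (false ∷_))

[]≔-∩-∉ : (Y P : Subset n) (m : Fin n) → lookup P m ≡ false → ∀ b → (Y [ m ]≔ b) ∩ P ≡ Y ∩ P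
[]≔-∩-∉ (y ∷ Y) (p ∷ P) zero    refl b = cong (_∷ (Y ∩ P)) (trans (∧-zeroʳ b) (sym (∧-zeroʳ y)))
[]≔-∩-∉ (y ∷ Y) (p ∷ P) (suc m) m∉P  b = cong ((y ∧ p) ∷_) ([]≔-∩-∉ Y P m m∉P b)

[]≔-∪-∈ : (Y P : Subset n) (m : Fin n) → lookup P m ≡ true → ∀ b → (Y [ m ]≔ b) ∪ P ≡ Y ∪ P
[]≔-∪-∈ (y ∷ Y) (p ∷ P) zero    refl b = cong (_∷ (Y ∪ P)) (trans (∨-zeroʳ b) (sym (∨-zeroʳ y)))
[]≔-∪-∈ (y ∷ Y) (p ∷ P) (suc m) m∈P  b = cong ((y ∨ p) ∷_) ([]≔-∪-∈ Y P m m∈P b)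

marginal-zero-≤ : (g : Subset (suc n) → ℚ) → Submodular g →
                  ∀ B → g (false ∷ B) + marginal g zero ≤ g (true ∷ B)
marginal-zero-≤ g g-submodular B = begin
  g (false ∷ B) + (g (true ∷ ⊤) - g (false ∷ ⊤))
    ≡⟨ solve 3 (λ b t f → b :+ (t :- f) := (t :+ b) :- f) refl (g (false ∷ B)) (g (true ∷ ⊤)) (g (false ∷ ⊤)) ⟩
  (g (true ∷ ⊤) + g (false ∷ B)) - g (false ∷ ⊤)
    ≡⟨ cong₂ (λ U V → (g (true ∷ U) + g (false ∷ V)) - g (false ∷ ⊤))
             (sym (∪-zeroʳ B)) (sym (∩-identityʳ B)) ⟩
  (g (true ∷ B ∪ ⊤) + g (false ∷ B ∩ ⊤)) - g (false ∷ ⊤)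
    ≤⟨ +-monoˡ-≤ (- g (false ∷ ⊤)) (g-submodular (true ∷ B) (false ∷ ⊤)) ⟩
  (g (true ∷ B) + g (false ∷ ⊤)) - g (false ∷ ⊤)
    ≡⟨ solve 2 (λ a b → (a :+ b) :- b := a) refl (g (true ∷ B)) (g (false ∷ ⊤)) ⟩
  g (true ∷ B) ∎
  where open ≤-Reasoning

𝔼-≥-marginals : ∀ {q} → 0ℚ ≤ q → q ≤ 1ℚ → (A : Subset n) (g : Subset n → ℚ) → Submodular g →
  g ⊥ + q * ∑[ m < n ] (𝟙 (lookup A m) * marginal g m) ≤ 𝔼 q A g
𝔼-≥-marginals {q = q} 0≤q q≤1 []          g _ =
  ≤-reflexive (trans (cong (g [] +_) (*-zeroʳ q)) (+-identityʳ (g [])))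
𝔼-≥-marginals {suc n} {q} 0≤q q≤1 (true ∷ A)  g g-submodular = begin
  g (false ∷ ⊥) + q * (1ℚ * d + S)
    ≡⟨ solve 4 (λ b q d s → b :+ q :* (con 1ℚ :* d :+ s) := (b :+ q :* s) :+ q :* d) refl (g (false ∷ ⊥)) q d S ⟩
  (g₀ ⊥ + q * S) + q * d
    ≤⟨ +-monoˡ-≤ (q * d) (𝔼-≥-marginals 0≤q q≤1 A g₀ (λ X Y → g-submodular (false ∷ X) (false ∷ Y))) ⟩
  𝔼 q A g₀ + q * d
    ≡⟨ solve 3 (λ e q d → e :+ q :* d := q :* (e :+ d) :+ (con 1ℚ :- q) :* e) refl (𝔼 q A g₀) q d ⟩
  q * (𝔼 q A g₀ + d) + (1ℚ - q) * 𝔼 q A g₀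
    ≡⟨ cong (λ e → q * e + (1ℚ - q) * 𝔼 q A g₀) (sym (𝔼-+-const q A g₀ d)) ⟩
  q * 𝔼 q A (λ X → g₀ X + d) + (1ℚ - q) * 𝔼 q A g₀
    ≤⟨ +-monoˡ-≤ ((1ℚ - q) * 𝔼 q A g₀)
                 (*-monoˡ-≤-0≤ 0≤q (𝔼-mono 0≤q q≤1 A (marginal-zero-≤ g g-submodular))) ⟩
  q * 𝔼 q A (g ∘ (true ∷_)) + (1ℚ - q) * 𝔼 q A g₀ ∎
  where
  open ≤-Reasoning
  g₀ : Subset n → ℚ
  g₀ = g ∘ (false ∷_)
  d = marginal g zero
  S = ∑[ m < n ] (𝟙 (lookup A m) * marginal g₀ m)
𝔼-≥-marginals {suc n} {q} 0≤q q≤1 (false ∷ A) g g-submodular = begin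
  g (false ∷ ⊥) + q * (0ℚ * marginal g zero + S)
    ≡⟨ cong (λ s → g (false ∷ ⊥) + q * s) (trans (cong (_+ S) (*-zeroˡ (marginal g zero))) (+-identityˡ S)) ⟩
  g (false ∷ ⊥) + q * S
    ≤⟨ 𝔼-≥-marginals 0≤q q≤1 A (g ∘ (false ∷_)) (λ X Y → g-submodular (false ∷ X) (false ∷ Y)) ⟩
  𝔼 q A (g ∘ (false ∷_)) ∎
  where
  open ≤-Reasoning
  S = ∑[ m < n ] (𝟙 (lookup A m) * marginal (g ∘ (false ∷_)) m)

∑-𝔼-≥-marginals : ∀ {q} → 0ℚ ≤ q → q ≤ 1ℚ → (xs : List A) (w : A → ℚ) → (∀ x → 0ℚ ≤ w x) →
  (S : A → Subset n) (g : Subset n → ℚ) → Submodular g →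
  (∑[ x ∈ xs ] w x) * g ⊥ + q * ∑[ m < n ] (∑[ x ∈ xs ] (w x * 𝟙 (lookup (S x) m)) * marginal g m)
    ≤ ∑[ x ∈ xs ] (w x * 𝔼 q (S x) g)
∑-𝔼-≥-marginals {A = A} {n = n} {q} 0≤q q≤1 xs w 0≤w S g g-submodular = begin
  (∑[ x ∈ xs ] w x) * g ⊥ + q * ∑[ m < n ] (∑[ x ∈ xs ] (w x * 𝟙ₘ x m) * marginal g m)
    ≡⟨ cong (λ s → (∑[ x ∈ xs ] w x) * g ⊥ + q * s) (sum-cong-≗ (λ m →
         *-distribʳ-∑∈ xs (marginal g m) (λ x → w x * 𝟙ₘ x m))) ⟩
  (∑[ x ∈ xs ] w x) * g ⊥ + q * ∑[ m < n ] ∑[ x ∈ xs ] (w x * 𝟙ₘ x m * marginal g m)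
    ≡⟨ cong (λ s → (∑[ x ∈ xs ] w x) * g ⊥ + q * s) (∑∈-∑<-comm xs n (λ x m → w x * 𝟙ₘ x m * marginal g m)) ⟨
  (∑[ x ∈ xs ] w x) * g ⊥ + q * ∑[ x ∈ xs ] ∑[ m < n ] (w x * 𝟙ₘ x m * marginal g m)
    ≡⟨ cong (λ s → (∑[ x ∈ xs ] w x) * g ⊥ + q * s) (∑∈-cong xs (λ {x} _ → trans
         (sum-cong-≗ (λ m → *-assoc (w x) (𝟙ₘ x m) (marginal g m)))
         (sym (*-distribˡ-sum (w x) (λ m → 𝟙ₘ x m * marginal g m))))) ⟩
  (∑[ x ∈ xs ] w x) * g ⊥ + q * ∑[ x ∈ xs ] (w x * M x)
    ≡⟨ cong₂ _+_ (*-distribʳ-∑∈ xs (g ⊥) w) (*-distribˡ-∑∈ xs q (λ x → w x * M x)) ⟩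
  ∑[ x ∈ xs ] (w x * g ⊥) + ∑[ x ∈ xs ] (q * (w x * M x))
    ≡⟨ ∑∈-distrib-+ xs (λ x → w x * g ⊥) (λ x → q * (w x * M x)) ⟨
  ∑[ x ∈ xs ] (w x * g ⊥ + q * (w x * M x))
    ≡⟨ ∑∈-cong xs (λ {x} _ → solve 4 (λ w b q m → w :* b :+ q :* (w :* m) := w :* (b :+ q :* m))
                                     refl (w x) (g ⊥) q (M x)) ⟩
  ∑[ x ∈ xs ] (w x * (g ⊥ + q * M x))
    ≤⟨ ∑∈-mono xs (λ {x} _ → *-monoˡ-≤-0≤ (0≤w x) (𝔼-≥-marginals 0≤q q≤1 (S x) g g-submodular)) ⟩
  ∑[ x ∈ xs ] (w x * 𝔼 q (S x) g) ∎
  where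
  open ≤-Reasoning
  𝟙ₘ : A → Fin n → ℚ
  𝟙ₘ x m = 𝟙 (lookup (S x) m)
  M : A → ℚ
  M x = ∑[ m < n ] (𝟙ₘ x m * marginal g m)

𝔼-≥-interpolation : ∀ {q} → 0ℚ ≤ q → q ≤ 1ℚ → (f : Subset n → ℚ) → Submodular f → ∀ X P →
  (1ℚ - q) * f X + q * f (X ∪ P) ≤ 𝔼 q P (λ Y → f (X ∪ Y))
𝔼-≥-interpolation {n} {q} 0≤q q≤1 f f-submodular X P = begin
  (1ℚ - q) * f X + q * f (X ∪ P)
    ≡⟨ solve 3 (λ q a b → (con 1ℚ :- q) :* a :+ q :* b := a :+ q :* (b :- a)) refl q (f X) (f (X ∪ P)) ⟩
  f X + q * (f (X ∪ P) - f X)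
    ≡⟨ cong₂ (λ a b → a + q * (b - a)) (sym h⊥) (sym h⊤) ⟩
  h ⊥ + q * (h ⊤ - h ⊥)
    ≡⟨ cong (λ s → h ⊥ + q * s) (sym (trans (sum-cong-≗ marginal-in-P) (∑-marginal h))) ⟩
  h ⊥ + q * ∑[ m < n ] (𝟙 (lookup P m) * marginal h m)
    ≤⟨ 𝔼-≥-marginals 0≤q q≤1 P h (submodular-∩ʳ (λ Y → f (X ∪ Y)) (submodular-∪ˡ f f-submodular X) P) ⟩
  𝔼 q P h
    ≡⟨ 𝔼-∩ q P (λ Y → f (X ∪ Y)) ⟨
  𝔼 q P (λ Y → f (X ∪ Y)) ∎
  where
  open ≤-Reasoning
  h : Subset n → ℚ
  h Y = f (X ∪ (Y ∩ P))
  h⊥ : h ⊥ ≡ f X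
  h⊥ = cong f (trans (cong (X ∪_) (∩-zeroˡ P)) (∪-identityʳ X))
  h⊤ : h ⊤ ≡ f (X ∪ P)
  h⊤ = cong (λ U → f (X ∪ U)) (∩-identityˡ P)
  marginal-in-P : ∀ m → 𝟙 (lookup P m) * marginal h m ≡ marginal h m
  marginal-in-P m with lookup P m in m∈?P
  ... | true  = *-identityˡ (marginal h m)
  ... | false = trans (*-zeroˡ (marginal h m)) (sym (marginal≡0 h m (λ Y →
                  cong (λ U → f (X ∪ U)) (trans ([]≔-∩-∉ Y P m m∈?P true) (sym ([]≔-∩-∉ Y P m m∈?P false))))))

𝔼-disjoint-∪-≥ : ∀ {q} → 0ℚ ≤ q → q ≤ 1ℚ → (f : Subset n → ℚ) → Submodular f → ∀ T P → T ∩ P ≡ ⊥ →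
  (1ℚ - q) * 𝔼 q T f + q * 𝔼 q T (λ X → f (X ∪ P)) ≤ 𝔼 q (T ∪ P) f
𝔼-disjoint-∪-≥ {q = q} 0≤q q≤1 f f-submodular T P T∩P≡⊥ = begin
  (1ℚ - q) * 𝔼 q T f + q * 𝔼 q T (λ X → f (X ∪ P))
    ≡⟨ 𝔼-linear q T (1ℚ - q) q f (λ X → f (X ∪ P)) ⟨
  𝔼 q T (λ X → (1ℚ - q) * f X + q * f (X ∪ P))
    ≤⟨ 𝔼-mono 0≤q q≤1 T (λ X → 𝔼-≥-interpolation 0≤q q≤1 f f-submodular X P) ⟩
  𝔼 q T (λ X → 𝔼 q P (λ Y → f (X ∪ Y)))
    ≡⟨ 𝔼-∪ q T P f T∩P≡⊥ ⟨
  𝔼 q (T ∪ P) f ∎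
  where open ≤-Reasoning

-- Permutations as vectors

⌊≟⌋-refl : ∀ (x : Fin k) → ⌊ x ≟ x ⌋ ≡ true
⌊≟⌋-refl x with x ≟ x
... | yes _   = refl
... | no  x≢x = ⊥-elim (x≢x refl)

⌊≟⌋-true : ∀ {x y : Fin k} → ⌊ x ≟ y ⌋ ≡ true → x ≡ y
⌊≟⌋-true {x = x} {y} x≟y with x ≟ y | x≟y
... | yes x≡y | _ = x≡y

⌊≟⌋-sym : ∀ (x y : Fin k) → ⌊ x ≟ y ⌋ ≡ ⌊ y ≟ x ⌋
⌊≟⌋-sym x y with x ≟ y | y ≟ x
... | yes _   | yes _   = refl
... | yes x≡y | no  y≢x = ⊥-elim (y≢x (sym x≡y))
... | no  x≢y | yes y≡x = ⊥-elim (x≢y (sym y≡x))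
... | no  _   | no  _   = refl

⌊≟⌋-injective : ∀ {k′} (σ : Fin k → Fin k′) → Injective _≡_ _≡_ σ →
                ∀ x y → ⌊ σ x ≟ σ y ⌋ ≡ ⌊ x ≟ y ⌋
⌊≟⌋-injective σ σ-injective x y with x ≟ y | σ x ≟ σ y
... | yes _    | yes _     = refl
... | yes refl | no σx≢σx  = ⊥-elim (σx≢σx refl)
... | no  x≢y  | yes σx≡σy = ⊥-elim (x≢y (σ-injective σx≡σy))
... | no  _    | no  _     = refl

⟨$⟩ʳ-injective : (σ : Permutation k k) → Injective _≡_ _≡_ (σ ⟨$⟩ʳ_)
⟨$⟩ʳ-injective σ {x} {y} σx≡σy = trans (sym (inverseˡ σ)) (trans (cong (σ ⟨$⟩ˡ_) σx≡σy) (inverseˡ σ))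

⌊≟⌋-permute : (σ : Permutation k k) (x y : Fin k) → ⌊ (σ ⟨$⟩ʳ x) ≟ y ⌋ ≡ ⌊ x ≟ (σ ⟨$⟩ˡ y) ⌋
⌊≟⌋-permute σ x y = trans (cong (λ z → ⌊ (σ ⟨$⟩ʳ x) ≟ z ⌋) (sym (inverseʳ σ)))
                          (⌊≟⌋-injective (σ ⟨$⟩ʳ_) (⟨$⟩ʳ-injective σ) x (σ ⟨$⟩ˡ y))

transpose-matchˡ : ∀ (i j : Fin k) → PC.transpose i j i ≡ j
transpose-matchˡ i j with i ≟ i
... | yes _   = refl
... | no  i≢i = ⊥-elim (i≢i refl)

transpose-other : ∀ (i j x : Fin k) → x ≢ i → x ≢ j → PC.transpose i j x ≡ x
transpose-other i j x x≢i x≢j with x ≟ i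
... | yes x≡i = ⊥-elim (x≢i x≡i)
... | no  _ with x ≟ j
...   | yes x≡j = ⊥-elim (x≢j x≡j)
...   | no  _   = refl

occurs : Fin k → Vec (Fin k) m → Bool
occurs x = Vec.foldr _ (λ y b → ⌊ x ≟ y ⌋ ∨ b) false

occurs≡false⇒∉ : ∀ (x : Fin k) (xs : Vec (Fin k) m) i → occurs x xs ≡ false → lookup xs i ≢ x
occurs≡false⇒∉ x (y ∷ xs) zero    x∉ refl with x ≟ x | x∉
... | yes _   | ()
... | no  x≢x | _  = x≢x refl
occurs≡false⇒∉ x (y ∷ xs) (suc i) x∉ xsᵢ≡x with ⌊ x ≟ y ⌋ | x∉
... | false | x∉xs = occurs≡false⇒∉ x xs i x∉xs xsᵢ≡x

distinct-∷⁻ : ∀ (x : Fin k) (xs : Vec (Fin k) m) → distinct (x ∷ xs) ≡ true →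
              occurs x xs ≡ false × distinct xs ≡ true
distinct-∷⁻ x xs d with occurs x xs | distinct xs
distinct-∷⁻ x xs refl | false | true = refl , refl

distinct⇒lookup-injective : ∀ (v : Vec (Fin k) m) → distinct v ≡ true → Injective _≡_ _≡_ (lookup v)
distinct⇒lookup-injective (x ∷ xs) d {zero}  {zero}  _ = refl
distinct⇒lookup-injective (x ∷ xs) d {zero}  {suc j} x≡xsⱼ =
  ⊥-elim (occurs≡false⇒∉ x xs j (proj₁ (distinct-∷⁻ x xs d)) (sym x≡xsⱼ))
distinct⇒lookup-injective (x ∷ xs) d {suc i} {zero}  xsᵢ≡x =
  ⊥-elim (occurs≡false⇒∉ x xs i (proj₁ (distinct-∷⁻ x xs d)) xsᵢ≡x)
distinct⇒lookup-injective (x ∷ xs) d {suc i} {suc j} xsᵢ≡xsⱼ =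
  cong suc (distinct⇒lookup-injective xs (proj₂ (distinct-∷⁻ x xs d)) xsᵢ≡xsⱼ)

module _ {k′} (σ : Fin k → Fin k′) (σ-injective : Injective _≡_ _≡_ σ) where

  occurs-map : ∀ x (xs : Vec (Fin k) m) → occurs (σ x) (Vec.map σ xs) ≡ occurs x xs
  occurs-map x []       = refl
  occurs-map x (y ∷ xs) = cong₂ _∨_ (⌊≟⌋-injective σ σ-injective x y) (occurs-map x xs)

  distinct-map : ∀ (v : Vec (Fin k) m) → distinct (Vec.map σ v) ≡ distinct v
  distinct-map []       = refl
  distinct-map (x ∷ xs) = cong₂ (λ a b → not a ∧ b) (occurs-map x xs) (distinct-map xs)

occurs-zero-map-suc : ∀ (xs : Vec (Fin k) m) → occurs zero (Vec.map suc xs) ≡ false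
occurs-zero-map-suc []       = refl
occurs-zero-map-suc (x ∷ xs) = occurs-zero-map-suc xs

distinct-tabulate-id : ∀ k → distinct (tabulate {n = k} id) ≡ true
distinct-tabulate-id zero    = refl
distinct-tabulate-id (suc k) = begin
  distinct (tabulate {n = suc k} id)
    ≡⟨ cong (λ (v : Vec (Fin (suc k)) k) → not (occurs zero v) ∧ distinct v) (tabulate-∘ suc id) ⟩
  not (occurs zero (Vec.map suc ids)) ∧ distinct (Vec.map suc ids)
    ≡⟨ cong₂ (λ a b → not a ∧ b) (occurs-zero-map-suc ids) (distinct-map suc suc-injective ids) ⟩
  distinct ids
    ≡⟨ distinct-tabulate-id k ⟩
  true ∎
  where
  open ≡-Reasoning
  ids : Vec (Fin k) k
  ids = tabulate id

∈-allVecs : ∀ (xs : List A) (v : Vec A m) → (∀ i → lookup v i ∈ xs) → v ∈ allVecs xs m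
∈-allVecs xs []      _       = here refl
∈-allVecs xs (x ∷ v) v⊆xs = ∈-concatMap⁺ (λ y → map (y ∷_) (allVecs xs _))
  (lose (v⊆xs zero) (∈-map⁺ (x ∷_) (∈-allVecs xs v (v⊆xs ∘ suc))))

∈-allPerms⇒distinct : ∀ {π : Vec (Fin k) k} → π ∈ allPerms k → distinct π ≡ true
∈-allPerms⇒distinct {k} π∈ =
  Equivalence.to T-≡ (proj₂ (∈-filter⁻ (T? ∘ distinct) {xs = allVecs (allFin k) k} π∈))

allPerms-nonZero : ∀ k → NonZero (length (allPerms k))
allPerms-nonZero k = ∈⇒nonZero (∈-filter⁺ (T? ∘ distinct)
  (∈-allVecs (allFin k) (tabulate id) (λ i → ∈-allFin _))
  (Equivalence.from T-≡ (distinct-tabulate-id k)))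
  where
  ∈⇒nonZero : ∀ {x : A} {xs} → x ∈ xs → NonZero (length xs)
  ∈⇒nonZero {xs = _ ∷ _} _ = _

∑-allFin-permute : (σ : Permutation k k) (G : Fin k → ℚ) →
                   ∑[ x ∈ allFin k ] G (σ ⟨$⟩ʳ x) ≡ ∑[ x ∈ allFin k ] G x
∑-allFin-permute {k} σ G = trans (∑∈-allFin k (G ∘ (σ ⟨$⟩ʳ_)))
  (trans (sym (sum-permute G σ)) (sym (∑∈-allFin k G)))

∑-allVecs-∷ : ∀ (xs : List A) m (H : Vec A (suc m) → ℚ) →
              ∑[ v ∈ allVecs xs (suc m) ] H v ≡ ∑[ x ∈ xs ] ∑[ v ∈ allVecs xs m ] H (x ∷ v)
∑-allVecs-∷ xs m H = trans (∑∈-concatMap (λ x → map (x ∷_) (allVecs xs m)) xs H)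
                           (∑∈-cong xs (λ {x} _ → ∑∈-map (x ∷_) (allVecs xs m) H))

∑-allVecs-permute : (σ : Permutation k k) (m : ℕ) (H : Vec (Fin k) m → ℚ) →
  ∑[ v ∈ allVecs (allFin k) m ] H (Vec.map (σ ⟨$⟩ʳ_) v) ≡ ∑[ v ∈ allVecs (allFin k) m ] H v
∑-allVecs-permute     σ zero    H = refl
∑-allVecs-permute {k} σ (suc m) H = begin
  ∑[ v ∈ allVecs (allFin k) (suc m) ] H (Vec.map (σ ⟨$⟩ʳ_) v)
    ≡⟨ ∑-allVecs-∷ (allFin k) m (H ∘ Vec.map (σ ⟨$⟩ʳ_)) ⟩
  ∑[ x ∈ allFin k ] ∑[ v ∈ allVecs (allFin k) m ] H ((σ ⟨$⟩ʳ x) ∷ Vec.map (σ ⟨$⟩ʳ_) v)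
    ≡⟨ ∑∈-cong (allFin k) (λ {x} _ → ∑-allVecs-permute σ m (λ v → H ((σ ⟨$⟩ʳ x) ∷ v))) ⟩
  ∑[ x ∈ allFin k ] ∑[ v ∈ allVecs (allFin k) m ] H ((σ ⟨$⟩ʳ x) ∷ v)
    ≡⟨ ∑-allFin-permute σ (λ y → ∑[ v ∈ allVecs (allFin k) m ] H (y ∷ v)) ⟩
  ∑[ x ∈ allFin k ] ∑[ v ∈ allVecs (allFin k) m ] H (x ∷ v)
    ≡⟨ ∑-allVecs-∷ (allFin k) m H ⟨
  ∑[ v ∈ allVecs (allFin k) (suc m) ] H v ∎
  where open ≡-Reasoning

∑-allPerms-permute : (σ : Permutation k k) (H : Vec (Fin k) k → ℚ) →
  ∑[ π ∈ allPerms k ] H (Vec.map (σ ⟨$⟩ʳ_) π) ≡ ∑[ π ∈ allPerms k ] H π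
∑-allPerms-permute {k} σ H = begin
  ∑[ π ∈ allPerms k ] H (Vec.map (σ ⟨$⟩ʳ_) π)
    ≡⟨ ∑∈-filterᵇ distinct (allVecs (allFin k) k) _ ⟩
  ∑[ v ∈ allVecs (allFin k) k ] (if distinct v then H (Vec.map (σ ⟨$⟩ʳ_) v) else 0ℚ)
    ≡⟨ ∑∈-cong (allVecs (allFin k) k) (λ {v} _ → cong (λ b → if b then H (Vec.map (σ ⟨$⟩ʳ_) v) else 0ℚ)
                                          (sym (distinct-map (σ ⟨$⟩ʳ_) (⟨$⟩ʳ-injective σ) v))) ⟩
  ∑[ v ∈ allVecs (allFin k) k ] H′ (Vec.map (σ ⟨$⟩ʳ_) v)
    ≡⟨ ∑-allVecs-permute σ k H′ ⟩
  ∑[ v ∈ allVecs (allFin k) k ] H′ v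
    ≡⟨ ∑∈-filterᵇ distinct (allVecs (allFin k) k) H ⟨
  ∑[ π ∈ allPerms k ] H π ∎
  where
  open ≡-Reasoning
  H′ : Vec (Fin k) k → ℚ
  H′ v = if distinct v then H v else 0ℚ

-- Prefixes of a permutation

anyFin : ∀ n → (Fin n → Bool) → Bool
anyFin zero    h = false
anyFin (suc n) h = h zero ∨ anyFin n (h ∘ suc)

anyFin-cong : ∀ n {g h : Fin n → Bool} → (∀ t → g t ≡ h t) → anyFin n g ≡ anyFin n h
anyFin-cong zero    g≡h = refl
anyFin-cong (suc n) g≡h = cong₂ _∨_ (g≡h zero) (anyFin-cong n (g≡h ∘ suc))

anyFin-false : ∀ n (h : Fin n → Bool) → (∀ t → h t ≡ false) → anyFin n h ≡ false
anyFin-false zero    h h≡false = refl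
anyFin-false (suc n) h h≡false rewrite h≡false zero = anyFin-false n (h ∘ suc) (h≡false ∘ suc)

foldr-∨-tabulate : ∀ n (h : A → Bool) (g : Fin n → A) →
                   List.foldr (λ x b → h x ∨ b) false (List.tabulate g) ≡ anyFin n (h ∘ g)
foldr-∨-tabulate zero    h g = refl
foldr-∨-tabulate (suc n) h g = cong (h (g zero) ∨_) (foldr-∨-tabulate n h (g ∘ suc))

anyFin-<ᵇ-suc : ∀ n p (p<n : p ℕ.< n) (h : Fin n → Bool) →
  anyFin n (λ t → (toℕ t ℕ.<ᵇ suc p) ∧ h t) ≡ anyFin n (λ t → (toℕ t ℕ.<ᵇ p) ∧ h t) ∨ h (fromℕ< p<n)
anyFin-<ᵇ-suc (suc n) zero    _             h rewrite anyFin-false n (λ _ → false) (λ _ → refl) =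
  ∨-identityʳ (h zero)
anyFin-<ᵇ-suc (suc n) (suc p) (ℕ.s≤s p<n) h rewrite anyFin-<ᵇ-suc n p p<n (h ∘ suc) =
  sym (∨-assoc (h zero) (anyFin n (λ t → (toℕ t ℕ.<ᵇ p) ∧ h (suc t))) (h (suc (fromℕ< p<n))))

𝟙-anyFin : ∀ n (h : Fin n → Bool) → (∀ t t′ → h t ≡ true → h t′ ≡ true → t ≡ t′) →
           𝟙 (anyFin n h) ≡ ∑[ t < n ] 𝟙 (h t)
𝟙-anyFin zero    h unique = refl
𝟙-anyFin (suc n) h unique with h zero in h₀
... | true  = sym (trans (cong (1ℚ +_) (trans (sum-cong-≗ rest-false) (sum-replicate-zero n)))
                        (+-identityʳ 1ℚ))
  where
  rest-false : ∀ t → 𝟙 (h (suc t)) ≡ 0ℚ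
  rest-false t with h (suc t) in hₜ
  ... | false = refl
  ... | true  with () ← unique zero (suc t) h₀ hₜ
... | false = trans (𝟙-anyFin n (h ∘ suc) (λ t t′ hₜ hₜ′ → suc-injective (unique (suc t) (suc t′) hₜ hₜ′)))
                    (sym (+-identityˡ _))

∑-𝟙-<ᵇ : ∀ n p → p ℕ.≤ n → ∑[ t < n ] 𝟙 (toℕ t ℕ.<ᵇ p) ≡ ℕ→ℚ p
∑-𝟙-<ᵇ n       zero    _             = trans (sum-replicate-zero n) (sym ℕ→ℚ-0)
∑-𝟙-<ᵇ (suc n) (suc p) (ℕ.s≤s p≤n) = trans (cong (1ℚ +_) (∑-𝟙-<ᵇ n p p≤n)) (sym (ℕ→ℚ-suc p))

tabulate-zipWith : ∀ {C : Set} (_•_ : A → B → C) (f : Fin n → A) (g : Fin n → B) →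
                   Vec.zipWith _•_ (tabulate f) (tabulate g) ≡ tabulate (λ x → f x • g x)
tabulate-zipWith {n = zero}  _•_ f g = refl
tabulate-zipWith {n = suc n} _•_ f g = cong ((f zero • g zero) ∷_) (tabulate-zipWith _•_ (f ∘ suc) (g ∘ suc))

tabulate-false≡⊥ : tabulate {n = n} (λ _ → false) ≡ ⊥
tabulate-false≡⊥ {zero}  = refl
tabulate-false≡⊥ {suc n} = cong (false ∷_) tabulate-false≡⊥

inPrefix : Vec (Fin k) k → ℕ → Fin k → Bool
inPrefix {k} π p l = anyFin k (λ t → (toℕ t ℕ.<ᵇ p) ∧ ⌊ lookup π t ≟ l ⌋)

T≡tabulate-inPrefix : (opt : Fin n → Fin k) (π : Vec (Fin k) k) (p : ℕ) →
                      T opt π p ≡ tabulate (λ x → inPrefix π p (opt x))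
T≡tabulate-inPrefix {k = k} opt π p =
  tabulate-cong (λ x → foldr-∨-tabulate k (λ t → (toℕ t ℕ.<ᵇ p) ∧ ⌊ lookup π t ≟ opt x ⌋) id)

lookup-T : (opt : Fin n → Fin k) (π : Vec (Fin k) k) (p : ℕ) (x : Fin n) →
           lookup (T opt π p) x ≡ inPrefix π p (opt x)
lookup-T opt π p x = trans (cong (λ v → lookup v x) (T≡tabulate-inPrefix opt π p))
                           (lookup∘tabulate (λ y → inPrefix π p (opt y)) x)

T-suc : (opt : Fin n → Fin k) (π : Vec (Fin k) k) (p : ℕ) (p<k : p ℕ.< k) →
        T opt π (suc p) ≡ T opt π p ∪ part opt (lookup π (fromℕ< p<k))
T-suc {k = k} opt π p p<k = begin
  T opt π (suc p)
    ≡⟨ T≡tabulate-inPrefix opt π (suc p) ⟩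
  tabulate (λ x → inPrefix π (suc p) (opt x))
    ≡⟨ tabulate-cong (λ x → trans (anyFin-<ᵇ-suc k p p<k (λ t → ⌊ lookup π t ≟ opt x ⌋))
                                     (cong (inPrefix π p (opt x) ∨_) (⌊≟⌋-sym _ _))) ⟩
  tabulate (λ x → inPrefix π p (opt x) ∨ ⌊ opt x ≟ lookup π (fromℕ< p<k) ⌋)
    ≡⟨ tabulate-zipWith _∨_ _ _ ⟨
  tabulate (λ x → inPrefix π p (opt x)) ∪ part opt (lookup π (fromℕ< p<k))
    ≡⟨ cong (_∪ part opt (lookup π (fromℕ< p<k))) (T≡tabulate-inPrefix opt π p) ⟨
  T opt π p ∪ part opt (lookup π (fromℕ< p<k)) ∎
  where open ≡-Reasoning

inPrefix-self : (π : Vec (Fin k) k) (p : ℕ) (p<k : p ℕ.< k) → distinct π ≡ true →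
                inPrefix π p (lookup π (fromℕ< p<k)) ≡ false
inPrefix-self {k} π p p<k π-distinct = anyFin-false k _ not-before
  where
  not-before : ∀ t → (toℕ t ℕ.<ᵇ p) ∧ ⌊ lookup π t ≟ lookup π (fromℕ< p<k) ⌋ ≡ false
  not-before t with ⌊ lookup π t ≟ lookup π (fromℕ< p<k) ⌋ in πₜ≟πₚ
  ... | false = ∧-zeroʳ _
  ... | true rewrite distinct⇒lookup-injective π π-distinct (⌊≟⌋-true πₜ≟πₚ) | toℕ-fromℕ< p<k =
    cong (_∧ true) (n<ᵇn p)
    where
    n<ᵇn : ∀ n → (n ℕ.<ᵇ n) ≡ false
    n<ᵇn zero    = refl
    n<ᵇn (suc n) = n<ᵇn n

T-∩-part≡⊥ : (opt : Fin n → Fin k) (π : Vec (Fin k) k) (p : ℕ) (p<k : p ℕ.< k) → distinct π ≡ true →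
             T opt π p ∩ part opt (lookup π (fromℕ< p<k)) ≡ ⊥
T-∩-part≡⊥ {k = k} opt π p p<k π-distinct = begin
  T opt π p ∩ part opt πₚ
    ≡⟨ cong (_∩ part opt πₚ) (T≡tabulate-inPrefix opt π p) ⟩
  tabulate (λ x → inPrefix π p (opt x)) ∩ part opt πₚ
    ≡⟨ tabulate-zipWith _∧_ _ _ ⟩
  tabulate (λ x → inPrefix π p (opt x) ∧ ⌊ opt x ≟ πₚ ⌋)
    ≡⟨ tabulate-cong disjoint ⟩
  tabulate (λ _ → false)
    ≡⟨ tabulate-false≡⊥ ⟩
  ⊥ ∎
  where
  open ≡-Reasoning
  πₚ = lookup π (fromℕ< p<k)
  disjoint : ∀ x → inPrefix π p (opt x) ∧ ⌊ opt x ≟ πₚ ⌋ ≡ false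
  disjoint x with ⌊ opt x ≟ πₚ ⌋ in optx≟πₚ
  ... | false = ∧-zeroʳ _
  ... | true rewrite ⌊≟⌋-true optx≟πₚ = cong (_∧ true) (inPrefix-self π p p<k π-distinct)

∑-𝟙-inPrefix : (π : Vec (Fin k) k) (p : ℕ) → p ℕ.≤ k → distinct π ≡ true →
               ∑[ l < k ] 𝟙 (inPrefix π p l) ≡ ℕ→ℚ p
∑-𝟙-inPrefix {k} π p p≤k π-distinct = begin
  ∑[ l < k ] 𝟙 (inPrefix π p l)
    ≡⟨ sum-cong-≗ (λ l → 𝟙-anyFin k _ (at-most-once l)) ⟩
  ∑[ l < k ] ∑[ t < k ] 𝟙 ((toℕ t ℕ.<ᵇ p) ∧ ⌊ lookup π t ≟ l ⌋)
    ≡⟨ ∑-comm (λ l t → 𝟙 ((toℕ t ℕ.<ᵇ p) ∧ ⌊ lookup π t ≟ l ⌋)) ⟩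
  ∑[ t < k ] ∑[ l < k ] 𝟙 ((toℕ t ℕ.<ᵇ p) ∧ ⌊ lookup π t ≟ l ⌋)
    ≡⟨ sum-cong-≗ (λ t → trans (sum-cong-≗ (λ l → 𝟙-∧ (toℕ t ℕ.<ᵇ p) ⌊ lookup π t ≟ l ⌋))
                               (sym (*-distribˡ-sum (𝟙 (toℕ t ℕ.<ᵇ p)) (λ l → 𝟙 ⌊ lookup π t ≟ l ⌋)))) ⟩
  ∑[ t < k ] (𝟙 (toℕ t ℕ.<ᵇ p) * ∑[ l < k ] 𝟙 ⌊ lookup π t ≟ l ⌋)
    ≡⟨ sum-cong-≗ (λ t → trans (cong (𝟙 (toℕ t ℕ.<ᵇ p) *_) (∑<-δ-1 k (lookup π t))) (*-identityʳ _)) ⟩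
  ∑[ t < k ] 𝟙 (toℕ t ℕ.<ᵇ p)
    ≡⟨ ∑-𝟙-<ᵇ k p p≤k ⟩
  ℕ→ℚ p ∎
  where
  open ≡-Reasoning
  at-most-once : ∀ l t t′ → (toℕ t ℕ.<ᵇ p) ∧ ⌊ lookup π t ≟ l ⌋ ≡ true →
                 (toℕ t′ ℕ.<ᵇ p) ∧ ⌊ lookup π t′ ≟ l ⌋ ≡ true → t ≡ t′
  at-most-once l t t′ hₜ hₜ′ = distinct⇒lookup-injective π π-distinct
    (trans (⌊≟⌋-true (∧-true₂ (toℕ t ℕ.<ᵇ p) hₜ)) (sym (⌊≟⌋-true (∧-true₂ (toℕ t′ ℕ.<ᵇ p) hₜ′))))
    where
    ∧-true₂ : ∀ a {b} → a ∧ b ≡ true → b ≡ true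
    ∧-true₂ true b≡true = b≡true

⌊lookup-map≟⌋ : (σ : Permutation k k) (π : Vec (Fin k) k) (t l : Fin k) →
  ⌊ lookup (Vec.map (σ ⟨$⟩ʳ_) π) t ≟ l ⌋ ≡ ⌊ lookup π t ≟ (σ ⟨$⟩ˡ l) ⌋
⌊lookup-map≟⌋ σ π t l =
  trans (cong (λ z → ⌊ z ≟ l ⌋) (lookup-map t (σ ⟨$⟩ʳ_) π)) (⌊≟⌋-permute σ (lookup π t) l)

inPrefix-map : (σ : Permutation k k) (π : Vec (Fin k) k) (p : ℕ) (l : Fin k) →
               inPrefix (Vec.map (σ ⟨$⟩ʳ_) π) p l ≡ inPrefix π p (σ ⟨$⟩ˡ l)
inPrefix-map {k} σ π p l = anyFin-cong k (λ t → cong ((toℕ t ℕ.<ᵇ p) ∧_) (⌊lookup-map≟⌋ σ π t l))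

-- Counting permutations

module Counting {k p : ℕ} (p<k : p ℕ.< k) where

  pₖ : Fin k
  pₖ = fromℕ< p<k

  Π : List (Vec (Fin k) k)
  Π = allPerms k

  𝟙[π[p]≡_] : Fin k → Vec (Fin k) k → ℚ
  𝟙[π[p]≡ j ] π = 𝟙 ⌊ lookup π pₖ ≟ j ⌋

  #at : Fin k → ℚ
  #at j = ∑[ π ∈ Π ] 𝟙[π[p]≡ j ] π

  #at∧inPrefix : Fin k → Fin k → ℚ
  #at∧inPrefix j l = ∑[ π ∈ Π ] (𝟙[π[p]≡ j ] π * 𝟙 (inPrefix π p l))

  #at-sym : ∀ j j′ → #at j ≡ #at j′
  #at-sym j j′ =
    trans (sym (∑-allPerms-permute σ 𝟙[π[p]≡ j ]))
          (∑∈-cong Π (λ {π} _ → cong 𝟙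
            (trans (⌊lookup-map≟⌋ σ π pₖ j) (cong (λ z → ⌊ lookup π pₖ ≟ z ⌋) (transpose-matchˡ j j′)))))
    where σ = transpose j′ j

  #at∧inPrefix-sym : ∀ j l l′ → l ≢ j → l′ ≢ j → #at∧inPrefix j l ≡ #at∧inPrefix j l′
  #at∧inPrefix-sym j l l′ l≢j l′≢j =
    trans (sym (∑-allPerms-permute σ (λ π → 𝟙[π[p]≡ j ] π * 𝟙 (inPrefix π p l))))
          (∑∈-cong Π (λ {π} _ → cong₂ (λ a b → 𝟙 a * 𝟙 b)
            (trans (⌊lookup-map≟⌋ σ π pₖ j) (cong (λ z → ⌊ lookup π pₖ ≟ z ⌋) σ⁻¹j≡j))
            (trans (inPrefix-map σ π p l) (cong (inPrefix π p) (transpose-matchˡ l l′)))))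
    where
    σ = transpose l′ l
    σ⁻¹j≡j : σ ⟨$⟩ˡ j ≡ j
    σ⁻¹j≡j = transpose-other l l′ j (l≢j ∘ sym) (l′≢j ∘ sym)

  #at∧inPrefix-self : ∀ j → #at∧inPrefix j j ≡ 0ℚ
  #at∧inPrefix-self j = begin
    #at∧inPrefix j j    ≡⟨ ∑∈-cong Π (λ {π} π∈Π → never π (∈-allPerms⇒distinct π∈Π)) ⟩
    ∑[ π ∈ Π ] 0ℚ       ≡⟨ ∑∈-const Π 0ℚ ⟩
    ℕ→ℚ (length Π) * 0ℚ ≡⟨ *-zeroʳ (ℕ→ℚ (length Π)) ⟩
    0ℚ                  ∎
    where
    open ≡-Reasoning
    never : ∀ π → distinct π ≡ true → 𝟙[π[p]≡ j ] π * 𝟙 (inPrefix π p j) ≡ 0ℚ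
    never π π-distinct with ⌊ lookup π pₖ ≟ j ⌋ in πₚ≟j
    ... | false = *-zeroˡ (𝟙 (inPrefix π p j))
    ... | true rewrite sym (⌊≟⌋-true πₚ≟j) | inPrefix-self π p p<k π-distinct = *-zeroʳ 1ℚ

  ∑-#at∧inPrefix : ∀ j → ∑[ l < k ] #at∧inPrefix j l ≡ ℕ→ℚ p * #at j
  ∑-#at∧inPrefix j = begin
    ∑[ l < k ] #at∧inPrefix j l
      ≡⟨ ∑∈-∑<-comm Π k (λ π l → 𝟙[π[p]≡ j ] π * 𝟙 (inPrefix π p l)) ⟨
    ∑[ π ∈ Π ] ∑[ l < k ] (𝟙[π[p]≡ j ] π * 𝟙 (inPrefix π p l))
      ≡⟨ ∑∈-cong Π (λ {π} π∈Π → count π (∈-allPerms⇒distinct π∈Π)) ⟩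
    ∑[ π ∈ Π ] (ℕ→ℚ p * 𝟙[π[p]≡ j ] π)
      ≡⟨ *-distribˡ-∑∈ Π (ℕ→ℚ p) 𝟙[π[p]≡ j ] ⟨
    ℕ→ℚ p * #at j ∎
    where
    open ≡-Reasoning
    count : ∀ π → distinct π ≡ true →
            ∑[ l < k ] (𝟙[π[p]≡ j ] π * 𝟙 (inPrefix π p l)) ≡ ℕ→ℚ p * 𝟙[π[p]≡ j ] π
    count π π-distinct = begin
      ∑[ l < k ] (𝟙[π[p]≡ j ] π * 𝟙 (inPrefix π p l))
        ≡⟨ *-distribˡ-sum (𝟙[π[p]≡ j ] π) (𝟙 ∘ inPrefix π p) ⟨
      𝟙[π[p]≡ j ] π * ∑[ l < k ] 𝟙 (inPrefix π p l)
        ≡⟨ cong (𝟙[π[p]≡ j ] π *_) (∑-𝟙-inPrefix π p (ℕₚ.<⇒≤ p<k) π-distinct) ⟩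
      𝟙[π[p]≡ j ] π * ℕ→ℚ p
        ≡⟨ *-comm (𝟙[π[p]≡ j ] π) (ℕ→ℚ p) ⟩
      ℕ→ℚ p * 𝟙[π[p]≡ j ] π ∎

  ∑-#at : ∑[ j < k ] #at j ≡ ℕ→ℚ (length Π)
  ∑-#at = begin
    ∑[ j < k ] #at j                   ≡⟨ ∑∈-∑<-comm Π k (λ π j → 𝟙[π[p]≡ j ] π) ⟨
    ∑[ π ∈ Π ] ∑[ j < k ] 𝟙[π[p]≡ j ] π ≡⟨ ∑∈-cong Π (λ {π} _ → ∑<-δ-1 k (lookup π pₖ)) ⟩
    ∑[ π ∈ Π ] 1ℚ                      ≡⟨ ∑∈-const Π 1ℚ ⟩
    ℕ→ℚ (length Π) * 1ℚ                ≡⟨ *-identityʳ _ ⟩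
    ℕ→ℚ (length Π)                     ∎
    where open ≡-Reasoning

  k*#at : ∀ j → ℕ→ℚ k * #at j ≡ ℕ→ℚ (length Π)
  k*#at j = trans (sym (∑<-const k (#at j))) (trans (sum-cong-≗ (#at-sym j)) ∑-#at)

  [k-1]*#at∧inPrefix : ∀ j l → l ≢ j → ℕ→ℚ (k ∸ 1) * #at∧inPrefix j l ≡ ℕ→ℚ p * #at j
  [k-1]*#at∧inPrefix j l l≢j = begin
    ℕ→ℚ (k ∸ 1) * c
      ≡⟨ solve 2 (λ m c → m :* c := (con 1ℚ :+ m) :* c :+ (:- con 1ℚ) :* c) refl (ℕ→ℚ (k ∸ 1)) c ⟩
    (1ℚ + ℕ→ℚ (k ∸ 1)) * c + (- 1ℚ) * c
      ≡⟨ cong (λ a → a * c + (- 1ℚ) * c) (ℕ→ℚ-∸1 p<k) ⟨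
    ℕ→ℚ k * c + (- 1ℚ) * c
      ≡⟨ cong₂ _+_ (∑<-const k c) (cong ((- 1ℚ) *_) (∑<-δ k j (λ _ → c))) ⟨
    ∑[ l′ < k ] c + (- 1ℚ) * ∑[ l′ < k ] (𝟙 ⌊ j ≟ l′ ⌋ * c)
      ≡⟨ cong (∑[ l′ < k ] c +_) (*-distribˡ-sum (- 1ℚ) (λ l′ → 𝟙 ⌊ j ≟ l′ ⌋ * c)) ⟩
    ∑[ l′ < k ] c + ∑[ l′ < k ] ((- 1ℚ) * (𝟙 ⌊ j ≟ l′ ⌋ * c))
      ≡⟨ ∑-distrib-+ (λ _ → c) (λ l′ → (- 1ℚ) * (𝟙 ⌊ j ≟ l′ ⌋ * c)) ⟨
    ∑[ l′ < k ] (c + (- 1ℚ) * (𝟙 ⌊ j ≟ l′ ⌋ * c))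
      ≡⟨ sum-cong-≗ equal-off-j ⟨
    ∑[ l′ < k ] #at∧inPrefix j l′
      ≡⟨ ∑-#at∧inPrefix j ⟩
    ℕ→ℚ p * #at j ∎
    where
    open ≡-Reasoning
    c = #at∧inPrefix j l
    equal-off-j : ∀ l′ → #at∧inPrefix j l′ ≡ c + (- 1ℚ) * (𝟙 ⌊ j ≟ l′ ⌋ * c)
    equal-off-j l′ with j ≟ l′
    ... | yes refl = trans (#at∧inPrefix-self j)
                       (solve 1 (λ c → con 0ℚ := c :+ (:- con 1ℚ) :* (con 1ℚ :* c)) refl c)
    ... | no  j≢l′ = trans (#at∧inPrefix-sym j l′ l (j≢l′ ∘ sym) l≢j)
                       (solve 1 (λ c → c := c :+ (:- con 1ℚ) :* (con 0ℚ :* c)) refl c)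

-- The step from T_p to T_{p+1}

module PartitionStep {n k : ℕ} .{{_ : NonZero k}} .{{_ : NonZero (k ∸ 1)}}
                     (f : Subset n → ℚ) (f-nonneg : ∀ A → 0ℚ ≤ f A) (f-submodular : Submodular f)
                     (opt : Fin n → Fin k) {p : ℕ} (p<k : p ℕ.< k) where

  open Counting p<k public

  -- N permutations put OPT_j at position p, and c of them also put a given OPT_l, l ≢ j, before it.
  q L N c : ℚ
  q = inv k
  L = ℕ→ℚ (length Π)
  N = q * L
  c = inv (k ∸ 1) * (ℕ→ℚ p * N)

  0≤q : 0ℚ ≤ q
  0≤q = 0≤inv k

  q≤1 : q ≤ 1ℚ
  q≤1 = inv≤1 k

  0≤c : 0ℚ ≤ c
  0≤c = 0≤*0≤⇒0≤ (0≤inv (k ∸ 1)) (0≤*0≤⇒0≤ (0≤ℕ→ℚ p) (0≤*0≤⇒0≤ 0≤q (0≤ℕ→ℚ (length Π))))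

  #at≡N : ∀ j → #at j ≡ N
  #at≡N j = *-solveˡ (inv k) (ℕ→ℚ k) (inv-inverseˡ k) (k*#at j)

  #at∧inPrefix≡c : ∀ j l → l ≢ j → #at∧inPrefix j l ≡ c
  #at∧inPrefix≡c j l l≢j =
    trans (*-solveˡ (inv (k ∸ 1)) (ℕ→ℚ (k ∸ 1)) (inv-inverseˡ (k ∸ 1)) ([k-1]*#at∧inPrefix j l l≢j))
          (cong (λ a → inv (k ∸ 1) * (ℕ→ℚ p * a)) (#at≡N j))

  g : Fin k → Subset n → ℚ
  g j X = f (X ∪ part opt j)

  #at∧∈T : Fin k → Fin n → ℚ
  #at∧∈T j m = ∑[ π ∈ Π ] (𝟙[π[p]≡ j ] π * 𝟙 (lookup (T opt π p) m))

  c*marginal-g : ∀ j m → c * marginal (g j) m ≡ #at∧∈T j m * marginal (g j) m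
  c*marginal-g j m with opt m ≟ j
  ... | yes refl = trans (cong (c *_) Δ≡0) (trans (*-zeroʳ c)
                     (sym (trans (cong (#at∧∈T (opt m) m *_) Δ≡0) (*-zeroʳ (#at∧∈T (opt m) m)))))
    where
    m∈part : lookup (part opt (opt m)) m ≡ true
    m∈part = trans (lookup∘tabulate (λ x → ⌊ opt x ≟ opt m ⌋) m) (⌊≟⌋-refl (opt m))
    Δ≡0 : marginal (g (opt m)) m ≡ 0ℚ
    Δ≡0 = marginal≡0 (g (opt m)) m (λ Y →
            cong f (trans ([]≔-∪-∈ Y _ m m∈part true) (sym ([]≔-∪-∈ Y _ m m∈part false))))
  ... | no opt-m≢j = cong (_* marginal (g j) m) (sym (trans
          (∑∈-cong Π (λ {π} _ → cong (λ b → 𝟙[π[p]≡ j ] π * 𝟙 b) (lookup-T opt π p m)))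
          (#at∧inPrefix≡c j (opt m) opt-m≢j)))

  ∑-𝔼-at-≥ : ∀ j → (N - q * c) * f (part opt j) ≤ ∑[ π ∈ Π ] (𝟙[π[p]≡ j ] π * 𝔼 q (T opt π p) (g j))
  ∑-𝔼-at-≥ j = begin
    (N - q * c) * f P
      ≡⟨ +-identityʳ _ ⟨
    (N - q * c) * f P + 0ℚ
      ≤⟨ +-monoʳ-≤ ((N - q * c) * f P) (0≤*0≤⇒0≤ (0≤*0≤⇒0≤ 0≤q 0≤c) (f-nonneg (⊤ ∪ P))) ⟩
    (N - q * c) * f P + q * c * g j ⊤
      ≡⟨ solve 5 (λ N q c a b → (N :- q :* c) :* a :+ q :* c :* b := N :* a :+ q :* (c :* (b :- a)))
                 refl N q c (f P) (g j ⊤) ⟩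
    N * f P + q * (c * (g j ⊤ - f P))
      ≡⟨ cong₂ (λ a b → a * b + q * (c * (g j ⊤ - b))) (#at≡N j) (cong f (∪-identityˡ P)) ⟨
    #at j * g j ⊥ + q * (c * (g j ⊤ - g j ⊥))
      ≡⟨ cong (λ s → #at j * g j ⊥ + q * s) (begin-equality
           c * (g j ⊤ - g j ⊥)                 ≡⟨ cong (c *_) (∑-marginal (g j)) ⟨
           c * ∑[ m < n ] marginal (g j) m      ≡⟨ *-distribˡ-sum c (marginal (g j)) ⟩
           ∑[ m < n ] (c * marginal (g j) m)    ≡⟨ sum-cong-≗ (c*marginal-g j) ⟩
           ∑[ m < n ] (#at∧∈T j m * marginal (g j) m) ∎) ⟩
    #at j * g j ⊥ + q * ∑[ m < n ] (#at∧∈T j m * marginal (g j) m)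
      ≤⟨ ∑-𝔼-≥-marginals 0≤q q≤1 Π 𝟙[π[p]≡ j ] (λ π → 0≤𝟙 _) (λ π → T opt π p) (g j)
                          (submodular-∪ʳ f f-submodular P) ⟩
    ∑[ π ∈ Π ] (𝟙[π[p]≡ j ] π * 𝔼 q (T opt π p) (g j)) ∎
    where
    open ≤-Reasoning
    P = part opt j

  G : Vec (Fin k) k → ℚ
  G π = 𝔼 q (T opt π p) (g (lookup π pₖ))

  ∑-G-≥ : (N - q * c) * partValue f opt ≤ ∑[ π ∈ Π ] G π
  ∑-G-≥ = begin
    (N - q * c) * partValue f opt
      ≡⟨ cong ((N - q * c) *_) (∑∈-allFin k (λ j → f (part opt j))) ⟩
    (N - q * c) * ∑[ j < k ] f (part opt j)
      ≡⟨ *-distribˡ-sum (N - q * c) (λ j → f (part opt j)) ⟩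
    ∑[ j < k ] ((N - q * c) * f (part opt j))
      ≤⟨ ∑<-mono k ∑-𝔼-at-≥ ⟩
    ∑[ j < k ] ∑[ π ∈ Π ] (𝟙[π[p]≡ j ] π * 𝔼 q (T opt π p) (g j))
      ≡⟨ ∑∈-∑<-comm Π k (λ π j → 𝟙[π[p]≡ j ] π * 𝔼 q (T opt π p) (g j)) ⟨
    ∑[ π ∈ Π ] ∑[ j < k ] (𝟙[π[p]≡ j ] π * 𝔼 q (T opt π p) (g j))
      ≡⟨ ∑∈-cong Π (λ {π} _ → ∑<-δ k (lookup π pₖ) (λ j → 𝔼 q (T opt π p) (g j))) ⟩
    ∑[ π ∈ Π ] G π ∎
    where open ≤-Reasoning

  E : ℕ → Vec (Fin k) k → ℚ
  E i π = 𝔼 q (T opt π i) f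

  E-step : ∀ π → distinct π ≡ true → (1ℚ - q) * E p π + q * G π ≤ E (suc p) π
  E-step π π-distinct = begin
    (1ℚ - q) * E p π + q * G π
      ≤⟨ 𝔼-disjoint-∪-≥ 0≤q q≤1 f f-submodular (T opt π p) (part opt (lookup π pₖ))
                         (T-∩-part≡⊥ opt π p p<k π-distinct) ⟩
    𝔼 q (T opt π p ∪ part opt (lookup π pₖ)) f
      ≡⟨ cong (λ A → 𝔼 q A f) (T-suc opt π p p<k) ⟨
    E (suc p) π ∎
    where open ≤-Reasoning

  ∑-E-step : (1ℚ - q) * ∑[ π ∈ Π ] E p π + q * ((N - q * c) * partValue f opt) ≤ ∑[ π ∈ Π ] E (suc p) π
  ∑-E-step = begin
    (1ℚ - q) * ∑[ π ∈ Π ] E p π + q * ((N - q * c) * partValue f opt)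
      ≤⟨ +-monoʳ-≤ ((1ℚ - q) * ∑[ π ∈ Π ] E p π) (*-monoˡ-≤-0≤ 0≤q ∑-G-≥) ⟩
    (1ℚ - q) * ∑[ π ∈ Π ] E p π + q * ∑[ π ∈ Π ] G π
      ≡⟨ cong₂ _+_ (*-distribˡ-∑∈ Π (1ℚ - q) (E p)) (*-distribˡ-∑∈ Π q G) ⟩
    ∑[ π ∈ Π ] ((1ℚ - q) * E p π) + ∑[ π ∈ Π ] (q * G π)
      ≡⟨ ∑∈-distrib-+ Π (λ π → (1ℚ - q) * E p π) (λ π → q * G π) ⟨
    ∑[ π ∈ Π ] ((1ℚ - q) * E p π + q * G π)
      ≤⟨ ∑∈-mono Π (λ {π} π∈Π → E-step π (∈-allPerms⇒distinct π∈Π)) ⟩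
    ∑[ π ∈ Π ] E (suc p) π ∎
    where open ≤-Reasoning

  Eπ-Esub : ∀ i → Eπ k (λ π → Esub q (T opt π i) f) ≡ inv (length Π) * ∑[ π ∈ Π ] E i π
  Eπ-Esub i = cong (inv (length Π) *_) (∑∈-cong Π (λ {π} _ → Esub≡𝔼 q (T opt π i) f))

lemma6p3 : (n k : ℕ) → 2 ℕ.≤ k
  → (f : Subset n → ℚ)
  → (∀ A → 0ℚ ≤ f A)
  → (∀ A B → f (A ∪ B) + f (A ∩ B) ≤ f A + f B)
  → (opt : Fin n → Fin k)
  → (∀ (q : Fin n → Fin k) → partValue f q ≤ partValue f opt)
  → (i : ℕ) → 1 ℕ.≤ i → i ℕ.≤ k
  → Eπ k (λ π → Esub (inv k) (T opt π i) f)
    ≥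
    ((1ℚ - inv k) * Eπ k (λ π → Esub (inv k) (T opt π (i ∸ 1)) f)
      + (1ℚ - ℕ→ℚ (i ∸ 1) * inv (k ℕ.* (k ∸ 1))) * (partValue f opt * inv (k ℕ.* k)))
lemma6p3 n k@(suc (suc _)) (ℕ.s≤s (ℕ.s≤s _)) f f-nonneg f-submodular opt _ (suc p) (ℕ.s≤s ℕ.z≤n) p<k = begin
  (1ℚ - q) * Eπ k (λ π → Esub q (T opt π p) f) + (1ℚ - ℕ→ℚ p * inv (k ℕ.* (k ∸ 1))) * (PV * inv (k ℕ.* k))
    ≡⟨ cong₂ (λ e r → (1ℚ - q) * e + (1ℚ - ℕ→ℚ p * r) * (PV * inv (k ℕ.* k)))
             (Eπ-Esub p) (inv-* k (k ∸ 1)) ⟩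
  (1ℚ - q) * (iL * S) + (1ℚ - ℕ→ℚ p * (q * r)) * (PV * inv (k ℕ.* k))
    ≡⟨ cong (λ s → (1ℚ - q) * (iL * S) + (1ℚ - ℕ→ℚ p * (q * r)) * (PV * s)) (inv-* k k) ⟩
  (1ℚ - q) * (iL * S) + (1ℚ - ℕ→ℚ p * (q * r)) * (PV * (q * q))
    ≡⟨ cong ((1ℚ - q) * (iL * S) +_) (trans
         (cong (_* ((1ℚ - ℕ→ℚ p * (q * r)) * (PV * (q * q)))) (inv-inverseˡ (length Π) {{allPerms-nonZero k}}))
         (*-identityˡ ((1ℚ - ℕ→ℚ p * (q * r)) * (PV * (q * q))))) ⟨
  (1ℚ - q) * (iL * S) + (iL * L) * ((1ℚ - ℕ→ℚ p * (q * r)) * (PV * (q * q)))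
    ≡⟨ solve 7 (λ iL L q r p S PV →
           (con 1ℚ :- q) :* (iL :* S) :+ (iL :* L) :* ((con 1ℚ :- p :* (q :* r)) :* (PV :* (q :* q)))
        := iL :* ((con 1ℚ :- q) :* S :+ q :* ((q :* L :- q :* (r :* (p :* (q :* L)))) :* PV)))
        refl iL L q r (ℕ→ℚ p) S PV ⟩
  iL * ((1ℚ - q) * S + q * ((N - q * c) * PV))
    ≤⟨ *-monoˡ-≤-0≤ (0≤inv (length Π)) ∑-E-step ⟩
  iL * ∑[ π ∈ Π ] E (suc p) π
    ≡⟨ Eπ-Esub (suc p) ⟨
  Eπ k (λ π → Esub q (T opt π (suc p)) f) ∎
  where
  open PartitionStep f f-nonneg f-submodular opt p<k
  open ≤-Reasoning
  iL r S PV : ℚ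
  iL = inv (length Π)
  r  = inv (k ∸ 1)
  S  = ∑[ π ∈ Π ] E p π
  PV = partValue f opt
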